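{- Let $M_n=\sum_{k\ge 0}\binom{n}{2k}C_k$ ($n\in\mathbb{N}$) be the Motzkin numbers, where $C_k=\frac{1}{k+1}\binom{2k}{k}$. Define the sequence $\mathbf{c}=(c_0,c_1,c_2,\ldots)$ by $c_0=1$ and, for $n\ge 0$, $c_{n+1}=c_n+1$ if $(c_n+1)/2$ is not a term of $\mathbf{c}$, and $c_{n+1}=c_n+2$ otherwise (so $\mathbf{c}=(1,3,4,5,7,\ldots)$). Then $M_n$ is even if and only if $n=4c_k-2$ or $n=4c_k-1$ for some $k\in\mathbb{N}$.
   Context: $\mathbb{N}$ denotes the nonnegative integers. Equivalently, $\mathbf{c}$ is the lexicographically least sequence of positive integers such that a positive integer $m$ is a term of $\mathbf{c}$ if and only if $m/2$ is not a term of $\mathbf{c}$. -}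

module Defs where

open import Data.Nat using (ℕ; zero; suc; _+_; _*_; _≡ᵇ_)
open import Data.Nat.DivMod using (_/_)
open import Data.Nat.Combinatorics using (_C_)
open import Data.List using (List; []; _∷_; map; upTo)
open import Data.Nat.ListAction using (sum)
open import Data.Bool.ListAction using (any)
open import Data.Bool using (Bool; if_then_else_)
open import Data.Product using (_×_; _,_; proj₁)

catalan : ℕ → ℕ
catalan k = ((2 * k) C k) / suc k

-- Motzkin number M_n = Σ_{k ≥ 0} binom(n,2k) C_k ; terms with 2k > n vanish,
-- so summing over k = 0 .. n suffices.
motzkin : ℕ → ℕ
motzkin n = sum (map (λ k → (n C (2 * k)) * catalan k) (upTo (suc n)))

halfIn : ℕ → List ℕ → Bool
halfIn y l = any (λ x → (x + x) ≡ᵇ y) l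

-- cPrefix n = (c_n , [c_n, c_{n-1}, ..., c_0])
cPrefix : ℕ → ℕ × List ℕ
cPrefix zero = 1 , 1 ∷ []
cPrefix (suc n) with cPrefix n
... | cn , l = let nxt = if halfIn (suc cn) l then cn + 2 else suc cn in nxt , nxt ∷ l

cseq : ℕ → ℕ
cseq n = proj₁ (cPrefix n)

-- Reducing mod 2 by Lucas' theorem, (2a+e choose 2k) ≡ (a choose k), so
-- M_n ≡ σ ⌊n/2⌋ where σ a = Σₖ (a choose k) Cₖ mod 2. Writing Cₖ as (2k choose k) - (2k choose k+1)
-- gives C_{2j+1} ≡ C_j and C_{2j+2} ≡ 0, whence σ (2b) ≡ 1 and σ (2b+1) ≡ 1 + σ b.
-- So χ m := σ (m - 1) satisfies χ (odd) = 1 and χ (2m) = 1 - χ m, the defining property of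
-- the terms of c, and the greedy construction of c enumerates {m ≥ 1 | χ m = 1} in order.
-- Hence M_n is even iff ⌊n/2⌋ = 2b+1 with b+1 a term of c, i.e. n ∈ {4c_k - 2, 4c_k - 1}.
module Submission where

import Algebra.Properties.CommutativeSemigroup as CommutativeSemigroupProperties
open import Data.Bool using (Bool; true; false; if_then_else_)
open import Data.Bool.Properties using (T-≡)
open import Data.Empty using (⊥-elim)
open import Data.List using (List; []; _∷_; map; upTo; applyUpTo)
open import Data.List.Membership.Propositional using (_∈_; find; lose)
open import Data.List.Properties using (map-upTo)
open import Data.List.Relation.Unary.Any using (here; there)
open import Data.List.Relation.Unary.Any.Properties using (any⁺; any⁻)
open import Data.Nat using (ℕ; zero; suc; _+_; _*_; _∸_; _≤_; _<_; _≡ᵇ_; z≤n; s≤s; z<s; parity; ⌊_/2⌋)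
open import Data.Nat.Combinatorics using (_C_; nC1≡n; nCk≡nC[n∸k]; nCk+nC[k+1]≡[n+1]C[k+1])
open import Data.Nat.Combinatorics.Specification using (k>n⇒nCk≡0)
open import Data.Nat.DivMod using (_/_; m*n/n≡m)
open import Data.Nat.Divisibility using (_∣_; divides)
open import Data.Nat.ListAction using (sum)
open import Data.Nat.Properties
open import Data.Nat.Solver using (module +-*-Solver)
open +-*-Solver using (solve; _:=_; _:+_; _:*_; con)
open import Data.Parity.Base using (Parity; 0ℙ; 1ℙ; _⁻¹) renaming (_+_ to _⊕_; _*_ to _⊗_)
import Data.Parity.Properties as ℙ
open import Data.Product using (_×_; _,_; proj₂; ∃; ∃-syntax)
open import Data.Sum using (_⊎_; inj₁; inj₂)
open import Defs
open import Function.Base using (_∘_; case_of_)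
open import Function.Bundles using (_⇔_; mk⇔; Equivalence)
import Function.Properties.Equivalence as ⇔
open import Relation.Binary.PropositionalEquality
open import Relation.Nullary using (yes; no)

double : ℕ → ℕ
double zero = zero
double (suc n) = suc (suc (double n))

double≡+ : ∀ n → double n ≡ n + n
double≡+ zero = refl
double≡+ (suc n) = cong suc (trans (cong suc (double≡+ n)) (sym (+-suc n n)))

double≡2* : ∀ n → double n ≡ 2 * n
double≡2* n = trans (double≡+ n) (cong (n +_) (sym (+-identityʳ n)))

n≤double : ∀ n → n ≤ double n
n≤double n = subst (n ≤_) (sym (double≡+ n)) (m≤m+n n n)

⌊double/2⌋≡ : ∀ a → ⌊ double a /2⌋ ≡ a
⌊double/2⌋≡ zero    = refl
⌊double/2⌋≡ (suc a) = cong suc (⌊double/2⌋≡ a)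

⌊suc-double/2⌋≡ : ∀ a → ⌊ suc (double a) /2⌋ ≡ a
⌊suc-double/2⌋≡ zero    = refl
⌊suc-double/2⌋≡ (suc a) = cong suc (⌊suc-double/2⌋≡ a)

double-injective : ∀ {x y} → x + x ≡ double y → x ≡ y
double-injective {x} {y} x+x≡2y = begin
  x              ≡⟨ n≡⌊n+n/2⌋ x ⟩
  ⌊ x + x /2⌋    ≡⟨ cong ⌊_/2⌋ x+x≡2y ⟩
  ⌊ double y /2⌋ ≡⟨ ⌊double/2⌋≡ y ⟩
  y              ∎
  where open ≡-Reasoning

4*[1+b]≡4+double[double[b]] : ∀ b → 4 * suc b ≡ 4 + double (double b)
4*[1+b]≡4+double[double[b]] b = begin
  4 * suc b             ≡⟨ *-suc 4 b ⟩
  4 + 4 * b             ≡⟨ cong (4 +_) (*-assoc 2 2 b) ⟩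
  4 + 2 * (2 * b)       ≡⟨ cong (λ m → 4 + 2 * m) (double≡2* b) ⟨
  4 + 2 * double b      ≡⟨ cong (4 +_) (double≡2* (double b)) ⟨
  4 + double (double b) ∎
  where open ≡-Reasoning

data Half : ℕ → Set where
  even : ∀ a → Half (double a)
  odd  : ∀ a → Half (suc (double a))

half : ∀ n → Half n
half zero = even zero
half (suc n) with half n
... | even a = odd a
... | odd a  = even (suc a)

⌊n/2⌋≡⇔ : ∀ {n a} → ⌊ n /2⌋ ≡ a ⇔ (n ≡ double a ⊎ n ≡ suc (double a))
⌊n/2⌋≡⇔ {n} {a} = mk⇔ (to (half n)) from
  where
  to : ∀ {n} → Half n → ⌊ n /2⌋ ≡ a → n ≡ double a ⊎ n ≡ suc (double a)
  to (even b) eq = inj₁ (cong double (trans (sym (⌊double/2⌋≡ b)) eq))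
  to (odd b)  eq = inj₂ (cong (suc ∘ double) (trans (sym (⌊suc-double/2⌋≡ b)) eq))
  from : n ≡ double a ⊎ n ≡ suc (double a) → ⌊ n /2⌋ ≡ a
  from (inj₁ refl) = ⌊double/2⌋≡ a
  from (inj₂ refl) = ⌊suc-double/2⌋≡ a

parity-double : ∀ n → parity (double n) ≡ 0ℙ
parity-double zero = refl
parity-double (suc n) = parity-double n

parity-suc-double : ∀ n → parity (suc (double n)) ≡ 1ℙ
parity-suc-double zero = refl
parity-suc-double (suc n) = parity-suc-double n

2∣⇔parity≡0ℙ : ∀ {m} → 2 ∣ m ⇔ parity m ≡ 0ℙ
2∣⇔parity≡0ℙ {m} = mk⇔ to from
  where
  to : 2 ∣ m → parity m ≡ 0ℙ
  to (divides k refl) = trans (ℙ.*-homo-* k 2) (ℙ.*-zeroʳ (parity k))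
  from : ∀ {m} → parity m ≡ 0ℙ → 2 ∣ m
  from {m} p with half m
  ... | even a = divides a (trans (double≡2* a) (*-comm 2 a))
  ... | odd a  = case trans (sym p) (parity-suc-double a) of λ ()

x+x≢1+2a : ∀ {x a} → x + x ≢ suc (double a)
x+x≢1+2a {x} {a} x+x≡2a+1 = case 0ℙ≡1ℙ of λ ()
  where
  open ≡-Reasoning
  0ℙ≡1ℙ : 0ℙ ≡ 1ℙ
  0ℙ≡1ℙ = begin
    0ℙ                        ≡⟨ parity-double x ⟨
    parity (double x)         ≡⟨ cong parity (trans (double≡+ x) x+x≡2a+1) ⟩
    parity (suc (double a))   ≡⟨ parity-suc-double a ⟩
    1ℙ                        ∎

⊕-cancel-middle : ∀ p q r → (p ⊕ q) ⊕ (q ⊕ r) ≡ p ⊕ r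
⊕-cancel-middle 0ℙ 0ℙ r = refl
⊕-cancel-middle 0ℙ 1ℙ r = ℙ.⁻¹-selfInverse refl
⊕-cancel-middle 1ℙ 0ℙ r = refl
⊕-cancel-middle 1ℙ 1ℙ r = refl

parity-∸ : ∀ {m n} → n ≤ m → parity (m ∸ n) ≡ parity m ⊕ parity n
parity-∸ {m} {n} n≤m = begin
  parity (m ∸ n)                        ≡⟨ ℙ.+-identityʳ _ ⟨
  parity (m ∸ n) ⊕ 0ℙ                   ≡⟨ cong (parity (m ∸ n) ⊕_) (ℙ.p+p≡0ℙ (parity n)) ⟨
  parity (m ∸ n) ⊕ (parity n ⊕ parity n) ≡⟨ ℙ.+-assoc (parity (m ∸ n)) (parity n) (parity n) ⟨
  parity (m ∸ n) ⊕ parity n ⊕ parity n   ≡⟨ cong (_⊕ parity n) (ℙ.+-homo-+ (m ∸ n) n) ⟨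
  parity (m ∸ n + n) ⊕ parity n          ≡⟨ cong (λ x → parity x ⊕ parity n) (m∸n+n≡m n≤m) ⟩
  parity m ⊕ parity n                    ∎
  where open ≡-Reasoning

pascal : ∀ n k → suc n C suc k ≡ n C k + n C suc k
pascal n k = sym (nCk+nC[k+1]≡[n+1]C[k+1] n k)

parity-pascal : ∀ n k → parity (suc n C suc k) ≡ parity (n C k) ⊕ parity (n C suc k)
parity-pascal n k = trans (cong parity (pascal n k)) (ℙ.+-homo-+ (n C k) (n C suc k))

-- Pascal's rule applied twice; the middle terms cancel since (1 + x)² ≡ 1 + x² mod 2.
parity-pascal² : ∀ n k → parity (suc (suc n) C suc (suc k)) ≡ parity (n C k) ⊕ parity (n C suc (suc k))
parity-pascal² n k = begin
  parity (suc (suc n) C suc (suc k))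
    ≡⟨ parity-pascal (suc n) (suc k) ⟩
  parity (suc n C suc k) ⊕ parity (suc n C suc (suc k))
    ≡⟨ cong₂ _⊕_ (parity-pascal n k) (parity-pascal n (suc k)) ⟩
  (parity (n C k) ⊕ parity (n C suc k)) ⊕ (parity (n C suc k) ⊕ parity (n C suc (suc k)))
    ≡⟨ ⊕-cancel-middle (parity (n C k)) (parity (n C suc k)) (parity (n C suc (suc k))) ⟩
  parity (n C k) ⊕ parity (n C suc (suc k)) ∎
  where open ≡-Reasoning

lucas-even-even : ∀ a b → parity (double a C double b) ≡ parity (a C b)
lucas-even-even zero    zero    = refl
lucas-even-even zero    (suc b) = refl
lucas-even-even (suc a) zero    = refl
lucas-even-even (suc a) (suc b) = begin
  parity (double (suc a) C double (suc b))
    ≡⟨ parity-pascal² (double a) (double b) ⟩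
  parity (double a C double b) ⊕ parity (double a C double (suc b))
    ≡⟨ cong₂ _⊕_ (lucas-even-even a b) (lucas-even-even a (suc b)) ⟩
  parity (a C b) ⊕ parity (a C suc b)
    ≡⟨ parity-pascal a b ⟨
  parity (suc a C suc b) ∎
  where open ≡-Reasoning

lucas-even-odd : ∀ a b → parity (double a C suc (double b)) ≡ 0ℙ
lucas-even-odd zero    b    = refl
lucas-even-odd (suc a) zero = begin
  parity (double (suc a) C 1) ≡⟨ cong parity (nC1≡n (double (suc a))) ⟩
  parity (double (suc a))     ≡⟨ parity-double (suc a) ⟩
  0ℙ                          ∎
  where open ≡-Reasoning
lucas-even-odd (suc a) (suc b) = begin
  parity (double (suc a) C suc (double (suc b)))
    ≡⟨ parity-pascal² (double a) (suc (double b)) ⟩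
  parity (double a C suc (double b)) ⊕ parity (double a C suc (double (suc b)))
    ≡⟨ cong₂ _⊕_ (lucas-even-odd a b) (lucas-even-odd a (suc b)) ⟩
  0ℙ ∎
  where open ≡-Reasoning

lucas-odd-even : ∀ a b → parity (suc (double a) C double b) ≡ parity (a C b)
lucas-odd-even a zero    = refl
lucas-odd-even a (suc b) = begin
  parity (suc (double a) C suc (suc (double b)))
    ≡⟨ parity-pascal (double a) (suc (double b)) ⟩
  parity (double a C suc (double b)) ⊕ parity (double a C double (suc b))
    ≡⟨ cong₂ _⊕_ (lucas-even-odd a b) (lucas-even-even a (suc b)) ⟩
  parity (a C suc b) ∎
  where open ≡-Reasoning

lucas-odd-odd : ∀ a b → parity (suc (double a) C suc (double b)) ≡ parity (a C b)
lucas-odd-odd a b = begin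
  parity (suc (double a) C suc (double b))
    ≡⟨ parity-pascal (double a) (double b) ⟩
  parity (double a C double b) ⊕ parity (double a C suc (double b))
    ≡⟨ cong₂ _⊕_ (lucas-even-even a b) (lucas-even-odd a b) ⟩
  parity (a C b) ⊕ 0ℙ
    ≡⟨ ℙ.+-identityʳ (parity (a C b)) ⟩
  parity (a C b) ∎
  where open ≡-Reasoning

central-binomial-even : ∀ m → parity (double (suc m) C suc m) ≡ 0ℙ
central-binomial-even m = begin
  parity (double (suc m) C suc m)         ≡⟨ cong parity (pascal (suc (double m)) m) ⟩
  parity (suc (double m) C m + x)         ≡⟨ cong (λ y → parity (y + x)) symmetric ⟩
  parity (x + x)                          ≡⟨ ℙ.+-homo-+ x x ⟩
  parity x ⊕ parity x                     ≡⟨ ℙ.p+p≡0ℙ (parity x) ⟩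
  0ℙ                                      ∎
  where
  open ≡-Reasoning
  x = suc (double m) C suc m
  symmetric : suc (double m) C m ≡ x
  symmetric = begin
    suc (double m) C m              ≡⟨ cong (suc (double m) C_) (m+n∸m≡n m m) ⟨
    suc (double m) C (m + m ∸ m)    ≡⟨ cong (λ y → suc (double m) C (y ∸ m)) (double≡+ m) ⟨
    suc (double m) C (double m ∸ m) ≡⟨ nCk≡nC[n∸k] (s≤s (subst (m ≤_) (sym (double≡+ m)) (m≤m+n m m))) ⟨
    x                               ∎

absorption : ∀ n k → suc k * (n C suc k) + k * (n C k) ≡ n * (n C k)
absorption zero zero = refl
absorption zero (suc k) = cong₂ _+_ (*-zeroʳ (2 + k)) (*-zeroʳ (1 + k))
absorption (suc n) zero = begin
  1 * (suc n C 1) + 0 ≡⟨ +-identityʳ _ ⟩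
  1 * (suc n C 1)     ≡⟨ *-identityˡ _ ⟩
  suc n C 1           ≡⟨ nC1≡n (suc n) ⟩
  suc n               ≡⟨ *-identityʳ (suc n) ⟨
  suc n * 1           ∎
  where open ≡-Reasoning
absorption (suc n) (suc k) rewrite pascal n (suc k) | pascal n k = begin
  (2 + k) * (b + c) + (1 + k) * (a + b)
    ≡⟨ solve 4 (λ k a b c → (con 2 :+ k) :* (b :+ c) :+ (con 1 :+ k) :* (a :+ b)
                        := ((con 2 :+ k) :* c :+ (con 1 :+ k) :* b) :+ ((con 1 :+ k) :* b :+ k :* a) :+ (a :+ b))
                refl k a b c ⟩
  ((2 + k) * c + (1 + k) * b) + ((1 + k) * b + k * a) + (a + b)
    ≡⟨ cong₂ (λ x y → x + y + (a + b)) (absorption n (suc k)) (absorption n k) ⟩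
  n * b + n * a + (a + b)
    ≡⟨ solve 3 (λ n a b → n :* b :+ n :* a :+ (a :+ b) := (con 1 :+ n) :* (a :+ b)) refl n a b ⟩
  (1 + n) * (a + b) ∎
  where
  open ≡-Reasoning
  a = n C k
  b = n C suc k
  c = n C suc (suc k)

module _ (k : ℕ) where
  private
    A = (2 * k) C k
    B = (2 * k) C suc k

  [1+k]*[2k]C[1+k]≡k*[2k]Ck : suc k * B ≡ k * A
  [1+k]*[2k]C[1+k]≡k*[2k]Ck = +-cancelʳ-≡ (k * A) (suc k * B) (k * A) (begin
    suc k * B + k * A ≡⟨ absorption (2 * k) k ⟩
    (k + (k + 0)) * A ≡⟨ cong (λ m → (k + m) * A) (+-identityʳ k) ⟩
    (k + k) * A       ≡⟨ *-distribʳ-+ A k k ⟩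
    k * A + k * A     ∎)
    where open ≡-Reasoning

  [2k]C[1+k]≤[2k]Ck : B ≤ A
  [2k]C[1+k]≤[2k]Ck = *-cancelˡ-≤ (suc k) (begin
    suc k * B ≡⟨ [1+k]*[2k]C[1+k]≡k*[2k]Ck ⟩
    k * A     ≤⟨ m≤n+m (k * A) A ⟩
    A + k * A ∎)
    where open ≤-Reasoning

  catalan≡[2k]Ck∸[2k]C[1+k] : catalan k ≡ A ∸ B
  catalan≡[2k]Ck∸[2k]C[1+k] = begin
    A / suc k               ≡⟨ cong (_/ suc k) A∸B*[1+k]≡A ⟨
    (A ∸ B) * suc k / suc k ≡⟨ m*n/n≡m (A ∸ B) (suc k) ⟩
    A ∸ B                   ∎
    where
    open ≡-Reasoning
    A∸B*[1+k]≡A : (A ∸ B) * suc k ≡ A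
    A∸B*[1+k]≡A = begin
      (A ∸ B) * suc k       ≡⟨ *-distribʳ-∸ (suc k) A B ⟩
      A * suc k ∸ B * suc k ≡⟨ cong₂ _∸_ (*-comm A (suc k)) (*-comm B (suc k)) ⟩
      suc k * A ∸ suc k * B ≡⟨ cong (suc k * A ∸_) [1+k]*[2k]C[1+k]≡k*[2k]Ck ⟩
      A + k * A ∸ k * A     ≡⟨ m+n∸n≡m A (k * A) ⟩
      A                     ∎

parity-catalan : ∀ k → parity (catalan k) ≡ parity (double k C k) ⊕ parity (double k C suc k)
parity-catalan k rewrite catalan≡[2k]Ck∸[2k]C[1+k] k | parity-∸ ([2k]C[1+k]≤[2k]Ck k) | double≡2* k = refl

parity-catalan-odd : ∀ j → parity (catalan (suc (double j))) ≡ parity (catalan j)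
parity-catalan-odd j = begin
  parity (catalan (suc (double j)))
    ≡⟨ parity-catalan (suc (double j)) ⟩
  parity (double n C suc (double j)) ⊕ parity (double n C double (suc j))
    ≡⟨ cong₂ _⊕_ (lucas-even-odd n j) (lucas-even-even n (suc j)) ⟩
  parity (suc (double j) C suc j)
    ≡⟨ parity-pascal (double j) j ⟩
  parity (double j C j) ⊕ parity (double j C suc j)
    ≡⟨ parity-catalan j ⟨
  parity (catalan j) ∎
  where
  open ≡-Reasoning
  n = suc (double j)

parity-catalan-even : ∀ j → parity (catalan (double (suc j))) ≡ 0ℙ
parity-catalan-even j = begin
  parity (catalan n)
    ≡⟨ parity-catalan n ⟩
  parity (double n C double (suc j)) ⊕ parity (double n C suc (double (suc j)))
    ≡⟨ cong₂ _⊕_ (lucas-even-even n (suc j)) (lucas-even-odd n (suc j)) ⟩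
  parity (double (suc j) C suc j) ⊕ 0ℙ
    ≡⟨ cong (_⊕ 0ℙ) (central-binomial-even j) ⟩
  0ℙ ∎
  where
  open ≡-Reasoning
  n = double (suc j)

sumℙ : (ℕ → Parity) → ℕ → Parity
sumℙ f zero    = 0ℙ
sumℙ f (suc n) = f 0 ⊕ sumℙ (f ∘ suc) n

parity-sum : ∀ g n → parity (sum (map g (upTo n))) ≡ sumℙ (parity ∘ g) n
parity-sum g n rewrite map-upTo g n = go g n
  where
  go : ∀ g n → parity (sum (applyUpTo g n)) ≡ sumℙ (parity ∘ g) n
  go g zero    = refl
  go g (suc n) = trans (ℙ.+-homo-+ (g 0) _) (cong (parity (g 0) ⊕_) (go (g ∘ suc) n))

sumℙ-cong : ∀ {f g} → (∀ k → f k ≡ g k) → ∀ n → sumℙ f n ≡ sumℙ g n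
sumℙ-cong f≗g zero    = refl
sumℙ-cong f≗g (suc n) = cong₂ _⊕_ (f≗g 0) (sumℙ-cong (f≗g ∘ suc) n)

sumℙ-⊕ : ∀ f g n → sumℙ (λ k → f k ⊕ g k) n ≡ sumℙ f n ⊕ sumℙ g n
sumℙ-⊕ f g zero    = refl
sumℙ-⊕ f g (suc n) = begin
  (f 0 ⊕ g 0) ⊕ sumℙ (λ k → f (suc k) ⊕ g (suc k)) n
    ≡⟨ cong (f 0 ⊕ g 0 ⊕_) (sumℙ-⊕ (f ∘ suc) (g ∘ suc) n) ⟩
  (f 0 ⊕ g 0) ⊕ (sumℙ (f ∘ suc) n ⊕ sumℙ (g ∘ suc) n)
    ≡⟨ interchange (f 0) (g 0) _ _ ⟩
  (f 0 ⊕ sumℙ (f ∘ suc) n) ⊕ (g 0 ⊕ sumℙ (g ∘ suc) n) ∎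
  where
  open ≡-Reasoning
  open CommutativeSemigroupProperties ℙ.+-commutativeSemigroup using (interchange)

sumℙ-pairs : ∀ f m → sumℙ f (double m) ≡ sumℙ (λ j → f (double j) ⊕ f (suc (double j))) m
sumℙ-pairs f zero    = refl
sumℙ-pairs f (suc m) = begin
  f 0 ⊕ (f 1 ⊕ sumℙ (f ∘ suc ∘ suc) (double m))
    ≡⟨ ℙ.+-assoc (f 0) (f 1) _ ⟨
  f 0 ⊕ f 1 ⊕ sumℙ (f ∘ suc ∘ suc) (double m)
    ≡⟨ cong (f 0 ⊕ f 1 ⊕_) (sumℙ-pairs (f ∘ suc ∘ suc) m) ⟩
  f 0 ⊕ f 1 ⊕ sumℙ (λ j → f (double (suc j)) ⊕ f (suc (double (suc j)))) m ∎
  where open ≡-Reasoning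

sumℙ-zero : ∀ {f} → (∀ k → f k ≡ 0ℙ) → ∀ n → sumℙ f n ≡ 0ℙ
sumℙ-zero f≗0 zero    = refl
sumℙ-zero f≗0 (suc n) = cong₂ _⊕_ (f≗0 0) (sumℙ-zero (f≗0 ∘ suc) n)

sumℙ-truncate : ∀ {f a n} → (∀ k → a ≤ k → f k ≡ 0ℙ) → a ≤ n → sumℙ f n ≡ sumℙ f a
sumℙ-truncate {n = n} f≗0 z≤n = sumℙ-zero (λ k → f≗0 k z≤n) n
sumℙ-truncate {f} f≗0 (s≤s a≤n) =
  cong (f 0 ⊕_) (sumℙ-truncate (λ k a≤k → f≗0 (suc k) (s≤s a≤k)) a≤n)

sumℙ-head : ∀ f → (∀ k → f (suc k) ≡ 0ℙ) → ∀ n → sumℙ f (suc n) ≡ f 0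
sumℙ-head f f≗0 n = trans (cong (f 0 ⊕_) (sumℙ-zero f≗0 n)) (ℙ.+-identityʳ (f 0))

σ-term : ℕ → ℕ → Parity
σ-term a k = parity (a C k) ⊗ parity (catalan k)

σ : ℕ → Parity
σ a = sumℙ (σ-term a) (suc a)

σ-term-vanishes : ∀ a k → suc a ≤ k → σ-term a k ≡ 0ℙ
σ-term-vanishes a k a<k rewrite k>n⇒nCk≡0 a<k = refl

parity-motzkin : ∀ n → parity (motzkin n) ≡ σ ⌊ n /2⌋
parity-motzkin n = begin
  parity (motzkin n)
    ≡⟨ parity-sum (λ k → (n C (2 * k)) * catalan k) (suc n) ⟩
  sumℙ (λ k → parity ((n C (2 * k)) * catalan k)) (suc n)
    ≡⟨ sumℙ-cong homo (suc n) ⟩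
  sumℙ (λ k → parity (n C double k) ⊗ parity (catalan k)) (suc n)
    ≡⟨ by-halving (half n) ⟩
  σ ⌊ n /2⌋ ∎
  where
  open ≡-Reasoning
  homo : ∀ k → parity ((n C (2 * k)) * catalan k) ≡ parity (n C double k) ⊗ parity (catalan k)
  homo k = trans (ℙ.*-homo-* (n C (2 * k)) (catalan k))
                 (cong (λ m → parity (n C m) ⊗ parity (catalan k)) (sym (double≡2* k)))
  by-halving : ∀ {n} → Half n →
               sumℙ (λ k → parity (n C double k) ⊗ parity (catalan k)) (suc n) ≡ σ ⌊ n /2⌋
  by-halving (even a) rewrite ⌊double/2⌋≡ a = begin
    sumℙ (λ k → parity (double a C double k) ⊗ parity (catalan k)) (suc (double a))
      ≡⟨ sumℙ-cong (λ k → cong (_⊗ parity (catalan k)) (lucas-even-even a k)) (suc (double a)) ⟩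
    sumℙ (σ-term a) (suc (double a))
      ≡⟨ sumℙ-truncate (σ-term-vanishes a) (s≤s (n≤double a)) ⟩
    σ a ∎
  by-halving (odd a) rewrite ⌊suc-double/2⌋≡ a = begin
    sumℙ (λ k → parity (suc (double a) C double k) ⊗ parity (catalan k)) (suc (suc (double a)))
      ≡⟨ sumℙ-cong (λ k → cong (_⊗ parity (catalan k)) (lucas-odd-even a k)) (suc (suc (double a))) ⟩
    sumℙ (σ-term a) (suc (suc (double a)))
      ≡⟨ sumℙ-truncate (σ-term-vanishes a) (s≤s (m≤n⇒m≤1+n (n≤double a))) ⟩
    σ a ∎

σ-double : ∀ b → σ (double b) ≡ 1ℙ
σ-double b = begin
  sumℙ (σ-term (double b)) (suc (double b))
    ≡⟨ sumℙ-truncate (σ-term-vanishes (double b)) (n≤1+n _) ⟨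
  sumℙ (σ-term (double b)) (double (suc b))
    ≡⟨ sumℙ-pairs (σ-term (double b)) (suc b) ⟩
  sumℙ pair (suc b)
    ≡⟨ sumℙ-head pair pair-vanishes b ⟩
  1ℙ ⊕ (parity (double b C 1) ⊗ 1ℙ)
    ≡⟨ cong (λ p → 1ℙ ⊕ (p ⊗ 1ℙ)) (lucas-even-odd b 0) ⟩
  1ℙ ∎
  where
  open ≡-Reasoning
  pair : ℕ → Parity
  pair j = σ-term (double b) (double j) ⊕ σ-term (double b) (suc (double j))
  pair-vanishes : ∀ j → pair (suc j) ≡ 0ℙ
  pair-vanishes j = cong₂ _⊕_
    (trans (cong (parity (double b C double (suc j)) ⊗_) (parity-catalan-even j)) (ℙ.*-zeroʳ _))
    (cong (_⊗ parity (catalan (suc (double (suc j))))) (lucas-even-odd b (suc j)))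

σ-suc-double : ∀ b → σ (suc (double b)) ≡ σ b ⁻¹
σ-suc-double b = begin
  sumℙ (σ-term n) (double (suc b))
    ≡⟨ sumℙ-pairs (σ-term n) (suc b) ⟩
  sumℙ (λ j → σ-term n (double j) ⊕ σ-term n (suc (double j))) (suc b)
    ≡⟨ sumℙ-cong pair-split (suc b) ⟩
  sumℙ (λ j → τ j ⊕ σ-term b j) (suc b)
    ≡⟨ sumℙ-⊕ τ (σ-term b) (suc b) ⟩
  sumℙ τ (suc b) ⊕ σ b
    ≡⟨ cong (_⊕ σ b) (sumℙ-head τ τ-vanishes b) ⟩
  1ℙ ⊕ σ b ∎
  where
  open ≡-Reasoning
  n = suc (double b)
  τ : ℕ → Parity
  τ j = parity (b C j) ⊗ parity (catalan (double j))
  pair-split : ∀ j → σ-term n (double j) ⊕ σ-term n (suc (double j)) ≡ τ j ⊕ σ-term b j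
  pair-split j rewrite lucas-odd-even b j | lucas-odd-odd b j | parity-catalan-odd j = refl
  τ-vanishes : ∀ j → τ (suc j) ≡ 0ℙ
  τ-vanishes j = trans (cong (parity (b C suc j) ⊗_) (parity-catalan-even j)) (ℙ.*-zeroʳ _)

σ≡0ℙ⇔ : ∀ {a} → σ a ≡ 0ℙ ⇔ (∃[ b ] a ≡ suc (double b) × σ b ≡ 1ℙ)
σ≡0ℙ⇔ {a} = mk⇔ (to (half a)) from
  where
  to : ∀ {a} → Half a → σ a ≡ 0ℙ → ∃[ b ] a ≡ suc (double b) × σ b ≡ 1ℙ
  to (even b) σa≡0 = case trans (sym σa≡0) (σ-double b) of λ ()
  to (odd b)  σa≡0 = b , refl , sym (ℙ.⁻¹-selfInverse (trans (sym (σ-suc-double b)) σa≡0))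
  from : ∃[ b ] a ≡ suc (double b) × σ b ≡ 1ℙ → σ a ≡ 0ℙ
  from (b , refl , σb≡1) = trans (σ-suc-double b) (cong _⁻¹ σb≡1)

motzkin-even⇔ : ∀ n → 2 ∣ motzkin n ⇔ (∃[ b ] ⌊ n /2⌋ ≡ suc (double b) × σ b ≡ 1ℙ)
motzkin-even⇔ n = ⇔.trans 2∣⇔parity≡0ℙ
  (subst (λ p → p ≡ 0ℙ ⇔ (∃[ b ] ⌊ n /2⌋ ≡ suc (double b) × σ b ≡ 1ℙ))
         (sym (parity-motzkin n)) σ≡0ℙ⇔)

-- χ m ≡ 1ℙ characterises the terms m ≥ 1 of c; the value χ 0 carries no meaning.
χ : ℕ → Parity
χ m = σ (m ∸ 1)

χ-no-two-consecutive-zeros : ∀ m → χ m ≡ 0ℙ → χ (suc m) ≡ 1ℙ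
χ-no-two-consecutive-zeros m χm≡0 with half m
... | even a = σ-double a
... | odd a  = case trans (sym χm≡0) (σ-double a) of λ ()

halfIn⇔ : ∀ y l → halfIn y l ≡ true ⇔ (∃[ x ] x ∈ l × x + x ≡ y)
halfIn⇔ y l = mk⇔ sound complete
  where
  p : ℕ → Bool
  p x = (x + x) ≡ᵇ y
  sound : halfIn y l ≡ true → ∃[ x ] x ∈ l × x + x ≡ y
  sound h with find (any⁻ p l (Equivalence.from T-≡ h))
  ... | x , x∈l , px = x , x∈l , ≡ᵇ⇒≡ (x + x) y px
  complete : ∃[ x ] x ∈ l × x + x ≡ y → halfIn y l ≡ true
  complete (x , x∈l , x+x≡y) = Equivalence.to T-≡ (any⁺ p (lose x∈l (≡⇒≡ᵇ (x + x) y x+x≡y)))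

next : ℕ → List ℕ → ℕ
next c l = if halfIn (suc c) l then c + 2 else suc c

prefix : ℕ → List ℕ
prefix n = proj₂ (cPrefix n)

record Enumerates (c : ℕ) (l : List ℕ) : Set where
  field
    sound    : ∀ {x} → x ∈ l → χ x ≡ 1ℙ
    complete : ∀ {x} → 1 ≤ x → x ≤ c → χ x ≡ 1ℙ → x ∈ l

open Enumerates

halfIn-suc⇔χ≡0ℙ : ∀ {c l} → Enumerates c l → halfIn (suc c) l ≡ true ⇔ χ (suc c) ≡ 0ℙ
halfIn-suc⇔χ≡0ℙ {c} {l} E with half c
... | even a = mk⇔ to from
  where
  to : halfIn (suc (double a)) l ≡ true → χ (suc (double a)) ≡ 0ℙ
  to h with Equivalence.to (halfIn⇔ _ l) h
  ... | x , _ , x+x≡2a+1 = ⊥-elim (x+x≢1+2a {x} {a} x+x≡2a+1)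
  from : χ (suc (double a)) ≡ 0ℙ → halfIn (suc (double a)) l ≡ true
  from χ≡0 = case trans (sym χ≡0) (σ-double a) of λ ()
... | odd a  = mk⇔ to from
  where
  to : halfIn (suc (suc (double a))) l ≡ true → χ (double (suc a)) ≡ 0ℙ
  to h with Equivalence.to (halfIn⇔ _ l) h
  ... | x , x∈l , x+x≡2a+2 rewrite double-injective {x} {suc a} x+x≡2a+2 =
    trans (σ-suc-double a) (cong _⁻¹ (sound E x∈l))
  from : χ (double (suc a)) ≡ 0ℙ → halfIn (suc (suc (double a))) l ≡ true
  from χ≡0 = Equivalence.from (halfIn⇔ _ l)
    (suc a , complete E (s≤s z≤n) (s≤s (n≤double a)) χ[1+a]≡1 , sym (double≡+ (suc a)))
    where
    χ[1+a]≡1 : χ (suc a) ≡ 1ℙ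
    χ[1+a]≡1 = sym (ℙ.⁻¹-selfInverse (trans (sym (σ-suc-double a)) χ≡0))

extend : ∀ {c l c′} → Enumerates c l → c < c′ → χ c′ ≡ 1ℙ →
         (∀ {x} → c < x → x < c′ → χ x ≡ 0ℙ) → Enumerates c′ (c′ ∷ l)
extend {c} {l} {c′} E c<c′ χc′≡1 gap = record { sound = sound′ ; complete = complete′ }
  where
  sound′ : ∀ {x} → x ∈ c′ ∷ l → χ x ≡ 1ℙ
  sound′ (here refl) = χc′≡1
  sound′ (there x∈l) = sound E x∈l
  complete′ : ∀ {x} → 1 ≤ x → x ≤ c′ → χ x ≡ 1ℙ → x ∈ c′ ∷ l
  complete′ {x} 1≤x x≤c′ χx≡1 with x ≤? c | m≤n⇒m<n∨m≡n x≤c′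
  ... | yes x≤c | _          = there (complete E 1≤x x≤c χx≡1)
  ... | no  _   | inj₂ refl  = here refl
  ... | no  x≰c | inj₁ x<c′ = case trans (sym χx≡1) (gap (≰⇒> x≰c) x<c′) of λ ()

c<next : ∀ c l → c < next c l
c<next c l with halfIn (suc c) l
... | true  = m<m+n c z<s
... | false = n<1+n c

enumerates-next : ∀ {c l} → Enumerates c l → Enumerates (next c l) (next c l ∷ l)
enumerates-next {c} {l} E with halfIn (suc c) l in h
... | true  = extend E (m<m+n c z<s) χ[c+2]≡1 gap
  where
  χ[1+c]≡0 : χ (suc c) ≡ 0ℙ
  χ[1+c]≡0 = Equivalence.to (halfIn-suc⇔χ≡0ℙ E) h
  χ[c+2]≡1 : χ (c + 2) ≡ 1ℙ
  χ[c+2]≡1 rewrite +-comm c 2 = χ-no-two-consecutive-zeros (suc c) χ[1+c]≡0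
  gap : ∀ {x} → c < x → x < c + 2 → χ x ≡ 0ℙ
  gap {x} c<x x<c+2 = subst (λ y → χ y ≡ 0ℙ) 1+c≡x χ[1+c]≡0
    where
    1+c≡x : suc c ≡ x
    1+c≡x = ≤-antisym c<x (≤-pred (subst (x <_) (+-comm c 2) x<c+2))
... | false = extend E (n<1+n c) χ[1+c]≡1 (λ c<x x<1+c → ⊥-elim (<-irrefl refl (≤-trans x<1+c c<x)))
  where
  χ[1+c]≡1 : χ (suc c) ≡ 1ℙ
  χ[1+c]≡1 with χ (suc c) in χ[1+c]
  ... | 1ℙ = refl
  ... | 0ℙ = case trans (sym h) (Equivalence.from (halfIn-suc⇔χ≡0ℙ E) χ[1+c]) of λ ()

enumerates : ∀ n → Enumerates (cseq n) (prefix n)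
enumerates zero    = record { sound = λ { (here refl) → refl } ; complete = one }
  where
  one : ∀ {x} → 1 ≤ x → x ≤ 1 → χ x ≡ 1ℙ → x ∈ 1 ∷ []
  one 1≤x x≤1 _ = here (≤-antisym x≤1 1≤x)
enumerates (suc n) = enumerates-next (enumerates n)

n<cseq : ∀ n → n < cseq n
n<cseq zero    = z<s
n<cseq (suc n) = ≤-trans (s≤s (n<cseq n)) (c<next (cseq n) (prefix n))

cseq∈prefix : ∀ n → cseq n ∈ prefix n
cseq∈prefix zero    = here refl
cseq∈prefix (suc n) = here refl

prefix⊆cseq : ∀ {n x} → x ∈ prefix n → ∃[ k ] cseq k ≡ x
prefix⊆cseq {zero}  (here refl) = zero , refl
prefix⊆cseq {suc n} (here refl) = suc n , refl
prefix⊆cseq {suc n} (there x∈) = prefix⊆cseq {n} x∈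

cseq-terms : ∀ b → (∃[ k ] cseq k ≡ suc b) ⇔ σ b ≡ 1ℙ
cseq-terms b = mk⇔
  (λ (k , cseqk≡1+b) → subst (λ m → χ m ≡ 1ℙ) cseqk≡1+b (sound (enumerates k) (cseq∈prefix k)))
  (λ σb≡1 → prefix⊆cseq {suc b} (complete (enumerates (suc b)) (s≤s z≤n) (<⇒≤ (n<cseq (suc b))) σb≡1))

cseq-positive : ∀ k → ∃[ b ] cseq k ≡ suc b
cseq-positive k with cseq k | n<cseq k
... | suc b | _ = b , refl

⌊n/2⌋≡1+2b⇔ : ∀ {n b} → ⌊ n /2⌋ ≡ suc (double b) ⇔ (n ≡ 4 * suc b ∸ 2 ⊎ n ≡ 4 * suc b ∸ 1)
⌊n/2⌋≡1+2b⇔ {n} {b} = subst (λ m → ⌊ n /2⌋ ≡ suc (double b) ⇔ (n ≡ m ∸ 2 ⊎ n ≡ m ∸ 1))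
                             (sym (4*[1+b]≡4+double[double[b]] b)) ⌊n/2⌋≡⇔

theorem3p1 : ∀ (n : ℕ) →
    (2 ∣ motzkin n) ⇔ ∃ (λ k → (n ≡ 4 * cseq k ∸ 2) ⊎ (n ≡ 4 * cseq k ∸ 1))
theorem3p1 n = mk⇔ to from
  where
  Near : ℕ → Set
  Near c = n ≡ 4 * c ∸ 2 ⊎ n ≡ 4 * c ∸ 1
  to : 2 ∣ motzkin n → ∃ (λ k → Near (cseq k))
  to 2∣Mn with Equivalence.to (motzkin-even⇔ n) 2∣Mn
  ... | b , ⌊n/2⌋≡1+2b , σb≡1 with Equivalence.from (cseq-terms b) σb≡1
  ...   | k , cseqk≡1+b = k , subst Near (sym cseqk≡1+b) (Equivalence.to ⌊n/2⌋≡1+2b⇔ ⌊n/2⌋≡1+2b)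
  from : ∃ (λ k → Near (cseq k)) → 2 ∣ motzkin n
  from (k , near) with cseq-positive k
  ... | b , cseqk≡1+b = Equivalence.from (motzkin-even⇔ n)
    (b , Equivalence.from ⌊n/2⌋≡1+2b⇔ (subst Near cseqk≡1+b near)
       , Equivalence.to (cseq-terms b) (k , cseqk≡1+b))
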